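{- Let $p$ be a prime with $p \equiv 7$ or $23 \pmod{40}$. Then: (a) there is no triple $(N,M,e) \in \mathbb{Z}^3$ with $M \neq 0$, $e \neq 0$ satisfying $N^2 = 5M^4 + 4pe^4$ together with $\gcd(N,e)=\gcd(M,e)=\gcd(5,e)=\gcd(4p,M)=\gcd(M,N)=1$; (b) there is no triple $(N,M,e) \in \mathbb{Z}^3$ with $M \neq 0$, $e \neq 0$ satisfying $N^2 = 20M^4 + pe^4$ together with $\gcd(N,e)=\gcd(M,e)=\gcd(20,e)=\gcd(p,M)=\gcd(M,N)=1$. -}

module Defs where

-- Everything happens modulo 5. Since gcd(5, e) = 1, Fermat gives e⁴ ≡ 1, so both
-- equations force N² ≡ 4p resp. N² ≡ p (mod 5). From p ≡ 7 or 23 (mod 40) we get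
-- p ≡ 2 or 3 and 4p ≡ 3 or 2 (mod 5), whereas the squares modulo 5 are 0, 1 and 4.
-- Only the hypothesis gcd(5, e) = 1 (resp. gcd(20, e) = 1) is needed.
module Submission where

open import Defs
open import Data.Nat using (ℕ)
open import Data.Nat.DivMod using (_%_)
open import Data.Nat.Primality using (Prime)
open import Data.Integer using (ℤ; +_; _+_; _*_; _^_)
open import Data.Integer.GCD using (gcd)
open import Data.Product using (_×_)
open import Data.Sum using (_⊎_)
open import Relation.Binary.PropositionalEquality using (_≡_; _≢_)
open import Relation.Nullary using (¬_)

import Data.Nat as ℕ
import Data.Nat.Properties as ℕ
open import Data.Nat using (zero; suc; _<_; s≤s; NonZero)
open import Data.Nat.DivMod
  using (%-distribˡ-*; %-remove-+ˡ; m%n%n≡m%n; m%n<n; m∣n⇒o%n%m≡o%m)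
open import Data.Nat.Divisibility using (_∣_; divides; ∣-refl; m∣m*n; m%n≡0⇒n∣m)
open import Data.Nat.Coprimality using (Coprime; gcd≡1⇒coprime)
open import Data.Integer using (∣_∣; -[1+_])
open import Data.Integer.Properties using (pos-*; pos-+; ^-*-assoc; +-injective)
open import Data.Product using (_,_)
open import Data.Sum using (inj₁; inj₂)
open import Function using (_∘_)
open import Relation.Binary.PropositionalEquality
  using (refl; sym; trans; cong; cong₂; subst; module ≡-Reasoning)
open import Relation.Nullary using (contradiction)

QuadraticNonResidue₅ : ℕ → Set
QuadraticNonResidue₅ n = n % 5 ≡ 2 ⊎ n % 5 ≡ 3

%-distribˡ-^ : ∀ m k d .{{_ : NonZero d}} → (m ℕ.^ k) % d ≡ ((m % d) ℕ.^ k) % d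
%-distribˡ-^ m zero    d = refl
%-distribˡ-^ m (suc k) d = begin
  (m ℕ.* m ℕ.^ k) % d                           ≡⟨ %-distribˡ-* m (m ℕ.^ k) d ⟩
  ((m % d) ℕ.* ((m ℕ.^ k) % d)) % d             ≡⟨ cong (λ x → ((m % d) ℕ.* x) % d) (%-distribˡ-^ m k d) ⟩
  ((m % d) ℕ.* (((m % d) ℕ.^ k) % d)) % d       ≡⟨ cong (λ x → (x ℕ.* (((m % d) ℕ.^ k) % d)) % d) (m%n%n≡m%n m d) ⟨
  (((m % d) % d) ℕ.* (((m % d) ℕ.^ k) % d)) % d ≡⟨ %-distribˡ-* (m % d) ((m % d) ℕ.^ k) d ⟨
  ((m % d) ℕ.* (m % d) ℕ.^ k) % d               ∎
  where open ≡-Reasoning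

fermat₅ : ∀ n → n % 5 ≢ 0 → (n ℕ.^ 4) % 5 ≡ 1
fermat₅ n n≢0 = trans (%-distribˡ-^ n 4 5) (residue (m%n<n n 5) n≢0)
  where
  residue : ∀ {r} → r < 5 → r ≢ 0 → (r ℕ.^ 4) % 5 ≡ 1
  residue {0} _ r≢0 = contradiction refl r≢0
  residue {1} _ _ = refl
  residue {2} _ _ = refl
  residue {3} _ _ = refl
  residue {4} _ _ = refl
  residue {suc (suc (suc (suc (suc _))))} (s≤s (s≤s (s≤s (s≤s (s≤s ()))))) _

nonResidue₅-cong : ∀ m n → m % 5 ≡ n % 5 → QuadraticNonResidue₅ m → QuadraticNonResidue₅ n
nonResidue₅-cong _ _ m≡n = subst (λ r → r ≡ 2 ⊎ r ≡ 3) m≡n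

square-not-nonResidue₅ : ∀ n → ¬ QuadraticNonResidue₅ (n ℕ.^ 2)
square-not-nonResidue₅ n =
  residue (m%n<n n 5) ∘ nonResidue₅-cong (n ℕ.^ 2) ((n % 5) ℕ.^ 2) (%-distribˡ-^ n 2 5)
  where
  residue : ∀ {r} → r < 5 → ¬ QuadraticNonResidue₅ (r ℕ.^ 2)
  residue {0} _ (inj₁ ())
  residue {0} _ (inj₂ ())
  residue {1} _ (inj₁ ())
  residue {1} _ (inj₂ ())
  residue {2} _ (inj₁ ())
  residue {2} _ (inj₂ ())
  residue {3} _ (inj₁ ())
  residue {3} _ (inj₂ ())
  residue {4} _ (inj₁ ())
  residue {4} _ (inj₂ ())
  residue {suc (suc (suc (suc (suc _))))} (s≤s (s≤s (s≤s (s≤s (s≤s ())))))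

nonResidue₅-4* : ∀ n → QuadraticNonResidue₅ n → QuadraticNonResidue₅ (4 ℕ.* n)
nonResidue₅-4* n (inj₁ n≡2) = inj₂ (trans (%-distribˡ-* 4 n 5) (cong (λ r → (4 ℕ.* r) % 5) n≡2))
nonResidue₅-4* n (inj₂ n≡3) = inj₁ (trans (%-distribˡ-* 4 n 5) (cong (λ r → (4 ℕ.* r) % 5) n≡3))

%40≡7∨23⇒nonResidue₅ : ∀ p → p % 40 ≡ 7 ⊎ p % 40 ≡ 23 → QuadraticNonResidue₅ p
%40≡7∨23⇒nonResidue₅ p p%40 =
  nonResidue₅-cong (p % 40) p (m∣n⇒o%n%m≡o%m 5 40 p (divides 8 refl)) (residue p%40)
  where
  residue : ∀ {r} → r ≡ 7 ⊎ r ≡ 23 → QuadraticNonResidue₅ r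
  residue (inj₁ refl) = inj₁ refl
  residue (inj₂ refl) = inj₂ refl

square≡5*+*fourth⇒%5 : ∀ x y b z → x ℕ.^ 2 ≡ 5 ℕ.* y ℕ.+ b ℕ.* z ℕ.^ 4 → z % 5 ≢ 0 →
  (x ℕ.^ 2) % 5 ≡ b % 5
square≡5*+*fourth⇒%5 x y b z eq z≢0 = begin
  (x ℕ.^ 2) % 5                    ≡⟨ cong (_% 5) eq ⟩
  (5 ℕ.* y ℕ.+ b ℕ.* z ℕ.^ 4) % 5  ≡⟨ %-remove-+ˡ (b ℕ.* z ℕ.^ 4) (m∣m*n y) ⟩
  (b ℕ.* z ℕ.^ 4) % 5              ≡⟨ %-distribˡ-* b (z ℕ.^ 4) 5 ⟩
  ((b % 5) ℕ.* ((z ℕ.^ 4) % 5)) % 5 ≡⟨ cong (λ r → ((b % 5) ℕ.* r) % 5) (fermat₅ z z≢0) ⟩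
  ((b % 5) ℕ.* 1) % 5              ≡⟨ cong (_% 5) (ℕ.*-identityʳ (b % 5)) ⟩
  (b % 5) % 5                      ≡⟨ m%n%n≡m%n b 5 ⟩
  b % 5                            ∎
  where open ≡-Reasoning

square≢5*+nonResidue₅*fourth : ∀ x y b z → QuadraticNonResidue₅ b → z % 5 ≢ 0 →
  x ℕ.^ 2 ≢ 5 ℕ.* y ℕ.+ b ℕ.* z ℕ.^ 4
square≢5*+nonResidue₅*fourth x y b z b-nonResidue z≢0 eq =
  square-not-nonResidue₅ x
    (nonResidue₅-cong b (x ℕ.^ 2) (sym (square≡5*+*fourth⇒%5 x y b z eq z≢0)) b-nonResidue)

coprime-∣ˡ⇒%≢0 : ∀ {d m n} .{{_ : NonZero d}} → d ≢ 1 → d ∣ m → Coprime m n → n % d ≢ 0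
coprime-∣ˡ⇒%≢0 {n = n} d≢1 d∣m coprime n%d≡0 = d≢1 (coprime (d∣m , m%n≡0⇒n∣m n _ n%d≡0))

pos-^ : ∀ m k → + (m ℕ.^ k) ≡ (+ m) ^ k
pos-^ m zero    = refl
pos-^ m (suc k) = trans (pos-* m (m ℕ.^ k)) (cong ((+ m) *_) (pos-^ m k))

square≡+∣∣^2 : ∀ i → i ^ 2 ≡ + (∣ i ∣ ℕ.^ 2)
square≡+∣∣^2 (+ n)    = sym (pos-^ n 2)
square≡+∣∣^2 -[1+ n ] = refl

fourth≡+∣∣^4 : ∀ i → i ^ 4 ≡ + (∣ i ∣ ℕ.^ 4)
fourth≡+∣∣^4 i = begin
  i ^ 4                     ≡⟨ ^-*-assoc i 2 2 ⟨
  (i ^ 2) ^ 2               ≡⟨ cong (_^ 2) (square≡+∣∣^2 i) ⟩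
  (+ (∣ i ∣ ℕ.^ 2)) ^ 2     ≡⟨ pos-^ (∣ i ∣ ℕ.^ 2) 2 ⟨
  + ((∣ i ∣ ℕ.^ 2) ℕ.^ 2)   ≡⟨ cong +_ (ℕ.^-*-assoc ∣ i ∣ 2 2) ⟩
  + (∣ i ∣ ℕ.^ 4)           ∎
  where open ≡-Reasoning

square≡+*fourth++*fourth⇒∣∣ : ∀ a b N M e → N ^ 2 ≡ + a * M ^ 4 + + b * e ^ 4 →
  ∣ N ∣ ℕ.^ 2 ≡ a ℕ.* ∣ M ∣ ℕ.^ 4 ℕ.+ b ℕ.* ∣ e ∣ ℕ.^ 4
square≡+*fourth++*fourth⇒∣∣ a b N M e eq = +-injective (begin
  + (∣ N ∣ ℕ.^ 2)                                        ≡⟨ square≡+∣∣^2 N ⟨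
  N ^ 2                                                  ≡⟨ eq ⟩
  + a * M ^ 4 + + b * e ^ 4                              ≡⟨ cong₂ (λ u v → + a * u + + b * v) (fourth≡+∣∣^4 M) (fourth≡+∣∣^4 e) ⟩
  + a * + (∣ M ∣ ℕ.^ 4) + + b * + (∣ e ∣ ℕ.^ 4)          ≡⟨ cong₂ _+_ (pos-* a _) (pos-* b _) ⟨
  + (a ℕ.* ∣ M ∣ ℕ.^ 4) + + (b ℕ.* ∣ e ∣ ℕ.^ 4)          ≡⟨ pos-+ (a ℕ.* ∣ M ∣ ℕ.^ 4) _ ⟨
  + (a ℕ.* ∣ M ∣ ℕ.^ 4 ℕ.+ b ℕ.* ∣ e ∣ ℕ.^ 4)            ∎)
  where open ≡-Reasoning

gcd≡1⇒coprime-∣∣ : ∀ k i → gcd (+ k) i ≡ + 1 → Coprime k ∣ i ∣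
gcd≡1⇒coprime-∣∣ k i = gcd≡1⇒coprime ∘ +-injective

N²≢5M⁴+4pe⁴ : ∀ p → QuadraticNonResidue₅ p → ∀ N M e → gcd (+ 5) e ≡ + 1 →
  N ^ 2 ≢ + 5 * M ^ 4 + + 4 * + p * e ^ 4
N²≢5M⁴+4pe⁴ p p-nonResidue N M e gcd[5,e]≡1 eq =
  square≢5*+nonResidue₅*fourth (∣ N ∣) (∣ M ∣ ℕ.^ 4) (4 ℕ.* p) (∣ e ∣)
    (nonResidue₅-4* p p-nonResidue)
    (coprime-∣ˡ⇒%≢0 (λ ()) ∣-refl (gcd≡1⇒coprime-∣∣ 5 e gcd[5,e]≡1))
    (square≡+*fourth++*fourth⇒∣∣ 5 (4 ℕ.* p) N M e
      (subst (λ c → N ^ 2 ≡ + 5 * M ^ 4 + c * e ^ 4) (sym (pos-* 4 p)) eq))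

N²≢20M⁴+pe⁴ : ∀ p → QuadraticNonResidue₅ p → ∀ N M e → gcd (+ 20) e ≡ + 1 →
  N ^ 2 ≢ + 20 * M ^ 4 + + p * e ^ 4
N²≢20M⁴+pe⁴ p p-nonResidue N M e gcd[20,e]≡1 eq =
  square≢5*+nonResidue₅*fourth (∣ N ∣) (4 ℕ.* ∣ M ∣ ℕ.^ 4) p (∣ e ∣)
    p-nonResidue
    (coprime-∣ˡ⇒%≢0 (λ ()) (divides 4 refl) (gcd≡1⇒coprime-∣∣ 20 e gcd[20,e]≡1))
    (trans (square≡+*fourth++*fourth⇒∣∣ 20 p N M e eq)
      (cong (ℕ._+ p ℕ.* ∣ e ∣ ℕ.^ 4) (ℕ.*-assoc 5 4 (∣ M ∣ ℕ.^ 4))))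

lemma3p6 : (p : ℕ) → Prime p → (p % 40 ≡ 7 ⊎ p % 40 ≡ 23) →
    ((N M e : ℤ) → M ≢ + 0 → e ≢ + 0 →
      ¬ (N ^ 2 ≡ + 5 * M ^ 4 + + 4 * + p * e ^ 4
         × gcd N e ≡ + 1 × gcd M e ≡ + 1 × gcd (+ 5) e ≡ + 1
         × gcd (+ 4 * + p) M ≡ + 1 × gcd M N ≡ + 1))
    × ((N M e : ℤ) → M ≢ + 0 → e ≢ + 0 →
      ¬ (N ^ 2 ≡ + 20 * M ^ 4 + + p * e ^ 4
         × gcd N e ≡ + 1 × gcd M e ≡ + 1 × gcd (+ 20) e ≡ + 1
         × gcd (+ p) M ≡ + 1 × gcd M N ≡ + 1))
lemma3p6 p _ p%40 =
  (λ N M e _ _ (eq , _ , _ , gcd[5,e]≡1 , _) → N²≢5M⁴+4pe⁴ p p-nonResidue N M e gcd[5,e]≡1 eq) ,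
  (λ N M e _ _ (eq , _ , _ , gcd[20,e]≡1 , _) → N²≢20M⁴+pe⁴ p p-nonResidue N M e gcd[20,e]≡1 eq)
  where
  p-nonResidue : QuadraticNonResidue₅ p
  p-nonResidue = %40≡7∨23⇒nonResidue₅ p p%40
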